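{- In $\mathbb F_q[x,y]$ one has $f_R(x,y)^p-f_R(x,y)=-x^{p^e}E_R(y)+xR(y)+yR(x)$. In particular, if $y\in\mathbb F$ satisfies $E_R(y)=0$, then $f_R(x,y)^p-f_R(x,y)=xR(y)+yR(x)$.
   Context: Let $p$ be a prime, $q=p^f$, $\mathbb F$ an algebraic closure of $\mathbb F_q$. Let $R(x)=\sum_{i=0}^e a_ix^{p^i}\in\mathbb F_q[x]$ with $a_e\neq 0$. Put $E_R(x)=R(x)^{p^e}+\sum_{i=0}^e(a_ix)^{p^{e-i}}$ and $f_R(x,y)=-\sum_{i=0}^{e-1}\big(\sum_{j=0}^{e-i-1}(a_ix^{p^i}y)^{p^j}+(xR(y))^{p^i}\big)$. -}

module Defs where

open import Level using (Level)
open import Data.Nat using (ℕ; zero; suc; _∸_) renaming (_^_ to _^ℕ_)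
open import Algebra.Bundles using (CommutativeRing)

module Poly {c ℓ : Level} (K : CommutativeRing c ℓ) where
  open CommutativeRing K

  pow : Carrier → ℕ → Carrier
  pow z zero    = 1#
  pow z (suc n) = z * pow z n

  natMul : ℕ → Carrier → Carrier
  natMul zero    z = 0#
  natMul (suc n) z = z + natMul n z

  sumTo : ℕ → (ℕ → Carrier) → Carrier
  sumTo zero    g = 0#
  sumTo (suc n) g = sumTo n g + g n

  Rpol : (p e : ℕ) (a : ℕ → Carrier) → Carrier → Carrier
  Rpol p e a x = sumTo (suc e) (λ i → a i * pow x (p ^ℕ i))

  ER : (p e : ℕ) (a : ℕ → Carrier) → Carrier → Carrier
  ER p e a x = pow (Rpol p e a x) (p ^ℕ e)
             + sumTo (suc e) (λ i → pow (a i * x) (p ^ℕ (e ∸ i)))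

  fR : (p e : ℕ) (a : ℕ → Carrier) → Carrier → Carrier → Carrier
  fR p e a x y = - sumTo e (λ i →
      sumTo (e ∸ i) (λ j → pow (a i * pow x (p ^ℕ i) * y) (p ^ℕ j))
      + pow (x * Rpol p e a y) (p ^ℕ i))

{-# OPTIONS --safe #-}
module Submission where

-- Write ℘ z = z ^ p − z. In characteristic p the Frobenius map, hence ℘, is additive,
-- and ℘ turns a sum u + u ^ p + … + u ^ (p ^ (n − 1)) into u ^ (p ^ n) − u. The function
-- f_R is minus a sum of such geometric sums: those in u = a_i x^{p^i} y contribute
-- x^{p^e} (a_i y)^{p^{e−i}} − y a_i x^{p^i}, those in u = x R(y) together contribute
-- x^{p^e} R(y)^{p^e} − x R(y). Summing over i < e gives −x^{p^e} E_R(y) + x R(y) + y R(x),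
-- since the i = e terms of E_R(y) and R(x) contribute −x^{p^e} a_e y and y a_e x^{p^e}.

open import Defs
open import Level using (Level)
open import Data.Nat using (ℕ; suc; _≤_) renaming (_^_ to _^ℕ_)
open import Data.Nat.Primality using (Prime)
open import Data.Product using (_×_)
open import Relation.Nullary using (¬_)
open import Algebra.Bundles using (CommutativeRing)

open import Data.Nat as ℕ using (zero; _∸_; _<_; z≤n; s≤s; _!)
import Data.Nat.Properties as ℕ
open import Data.Nat.Divisibility using (_∣_; _∤_; divides; ∣⇒≤; ∣1⇒≡1; m∣m*n)
open import Data.Nat.DivMod using (m/n*n≡m)
open import Data.Nat.Primality using (euclidsLemma; ¬prime[1])
open import Data.Nat.Combinatorics using (_C_; k![n∸k]!∣n!; nCn≡1)
open import Data.Nat.Combinatorics.Specification using (nCk≡n!/k![n-k]!)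
open import Data.Product using (_,_)
open import Data.Sum using (inj₁; inj₂; [_,_]′)
open import Data.Empty using (⊥-elim)
open import Data.Maybe using (Maybe; just; nothing)
open import Data.Fin as Fin using (Fin; fromℕ; inject₁)
import Data.Fin.Properties as Fin
open import Function using (_∘_; id)
open import Relation.Nullary using (yes; no)
open import Relation.Binary.PropositionalEquality as ≡ using (_≡_)

prime∤m! : ∀ {p m} → Prime p → m < p → p ∤ m !
prime∤m! {m = zero}  p-prime _   p∣1  = ¬prime[1] (≡.subst Prime (∣1⇒≡1 p∣1) p-prime)
prime∤m! {m = suc m} p-prime m<p p∣m! with euclidsLemma (suc m) (m !) p-prime p∣m!
... | inj₁ p∣1+m = ℕ.<⇒≱ m<p (∣⇒≤ p∣1+m)
... | inj₂ p∣m!′ = prime∤m! p-prime (ℕ.<-trans (ℕ.n<1+n m) m<p) p∣m!′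

-- p divides p! = (p C k) · k! · (p ∸ k)! but neither k! nor (p ∸ k)!.
prime∣pCk : ∀ {p k} → Prime p → 0 < k → k < p → p ∣ p C k
prime∣pCk {p@(suc q)} {k} p-prime 0<k k<p@(s≤s _) =
  [ id , ⊥-elim ∘ p∤k![p∸k]! ]′
    (euclidsLemma (p C k) _ p-prime (≡.subst (p ∣_) (≡.sym factorials) p∣p!))
  where
  k≤p : k ≤ p
  k≤p = ℕ.<⇒≤ k<p
  instance
    k![p∸k]!≢0 : ℕ.NonZero (k ! ℕ.* (p ∸ k) !)
    k![p∸k]!≢0 = ℕ._!*_!≢0 k (p ∸ k)
  factorials : (p C k) ℕ.* (k ! ℕ.* (p ∸ k) !) ≡ p !
  factorials = ≡.trans (≡.cong (ℕ._* (k ! ℕ.* (p ∸ k) !)) (nCk≡n!/k![n-k]! k≤p))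
                       (m/n*n≡m (k![n∸k]!∣n! k≤p))
  p∣p! : p ∣ p !
  p∣p! = m∣m*n (q !)
  p∤k![p∸k]! : p ∤ k ! ℕ.* (p ∸ k) !
  p∤k![p∸k]! = [ prime∤m! p-prime k<p , prime∤m! p-prime (ℕ.∸-monoʳ-< 0<k k≤p) ]′
             ∘ euclidsLemma (k !) ((p ∸ k) !) p-prime

-- A ring solver for an arbitrary commutative ring, with integer coefficients
-- represented as pairs (a , b) standing for a − b.
module RingSolver {c ℓ : Level} (K : CommutativeRing c ℓ) where
  open CommutativeRing K
  open import Algebra.Bundles using (RawRing)
  open import Algebra.Properties.Semiring.Mult semiring using (×-homo-+; ×1-homo-*)
    renaming (_×_ to _×ₙ_)
  open import Algebra.Properties.Ring ring using (-‿distribˡ-*; -‿distribʳ-*)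
  open import Algebra.Properties.Group +-group using (⁻¹-involutive; ε⁻¹≈ε)
  open import Algebra.Properties.AbelianGroup +-abelianGroup using (⁻¹-∙-comm; ⁻¹-anti-homo‿-)
  open import Algebra.Solver.Ring.AlmostCommutativeRing
    using (fromCommutativeRing; _-Raw-AlmostCommutative⟶_)
  import Algebra.Solver.Ring.NaturalCoefficients.Default commutativeSemiring as SemiringSolver
  open import Relation.Binary.Reasoning.Setoid setoid

  [a-b]+[c-d]≈[a+c]-[b+d] : ∀ a b c d → (a - b) + (c - d) ≈ (a + c) - (b + d)
  [a-b]+[c-d]≈[a+c]-[b+d] a b c d = begin
    (a - b) + (c - d)     ≈⟨ solve 4 (λ a -b c -d → (a :+ -b) :+ (c :+ -d) := (a :+ c) :+ (-b :+ -d))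
                                     refl a (- b) c (- d) ⟩
    (a + c) + (- b + - d) ≈⟨ +-congˡ (⁻¹-∙-comm b d) ⟩
    (a + c) - (b + d)     ∎
    where open SemiringSolver using (solve; _:+_; _:=_)

  [a-b]*[c-d]≈[ac+bd]-[ad+bc] : ∀ a b c d → (a - b) * (c - d) ≈ (a * c + b * d) - (a * d + b * c)
  [a-b]*[c-d]≈[ac+bd]-[ad+bc] a b c d = begin
    (a - b) * (c - d)
      ≈⟨ solve 4 (λ a -b c -d → (a :+ -b) :* (c :+ -d) := (a :* c :+ -b :* -d) :+ (a :* -d :+ -b :* c))
               refl a (- b) c (- d) ⟩
    (a * c + (- b) * (- d)) + (a * (- d) + (- b) * c)
      ≈⟨ +-cong (+-congˡ -b*-d≈b*d) (+-cong (sym (-‿distribʳ-* a d)) (sym (-‿distribˡ-* b c))) ⟩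
    (a * c + b * d) + (- (a * d) + - (b * c))
      ≈⟨ +-congˡ (⁻¹-∙-comm _ _) ⟩
    (a * c + b * d) - (a * d + b * c) ∎
    where
    open SemiringSolver using (solve; _:+_; _:*_; _:=_)
    -b*-d≈b*d : (- b) * (- d) ≈ b * d
    -b*-d≈b*d = begin
      (- b) * (- d) ≈⟨ -‿distribˡ-* b (- d) ⟨
      - (b * - d)   ≈⟨ -‿cong (-‿distribʳ-* b d) ⟨
      - - (b * d)   ≈⟨ ⁻¹-involutive (b * d) ⟩
      b * d         ∎

  a+d≈c+b⇒a-b≈c-d : ∀ {a b c d} → a + d ≈ c + b → a - b ≈ c - d
  a+d≈c+b⇒a-b≈c-d {a} {b} {c} {d} a+d≈c+b = begin
    a - b                 ≈⟨ +-identityʳ _ ⟨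
    (a - b) + 0#          ≈⟨ +-congˡ (-‿inverseʳ d) ⟨
    (a - b) + (d - d)     ≈⟨ [a-b]+[c-d]≈[a+c]-[b+d] a b d d ⟩
    (a + d) - (b + d)     ≈⟨ +-cong a+d≈c+b (-‿cong (+-comm b d)) ⟩
    (c + b) - (d + b)     ≈⟨ [a-b]+[c-d]≈[a+c]-[b+d] c d b b ⟨
    (c - d) + (b - b)     ≈⟨ +-congˡ (-‿inverseʳ b) ⟩
    (c - d) + 0#          ≈⟨ +-identityʳ _ ⟩
    c - d                 ∎

  IntegerPairs : RawRing _ _
  IntegerPairs = record
    { Carrier = ℕ × ℕ
    ; _≈_     = _≡_
    ; _+_     = λ { (a , b) (c , d) → (a ℕ.+ c , b ℕ.+ d) }
    ; _*_     = λ { (a , b) (c , d) → (a ℕ.* c ℕ.+ b ℕ.* d , a ℕ.* d ℕ.+ b ℕ.* c) }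
    ; -_      = λ { (a , b) → (b , a) }
    ; 0#      = (0 , 0)
    ; 1#      = (1 , 0)
    }

  ⟦_⟧ : ℕ × ℕ → Carrier
  ⟦ (a , b) ⟧ = a ×ₙ 1# - b ×ₙ 1#

  homomorphism : IntegerPairs -Raw-AlmostCommutative⟶ fromCommutativeRing K
  homomorphism = record
    { ⟦_⟧    = ⟦_⟧
    ; +-homo = λ { (a , b) (c , d) →
        trans (+-cong (×-homo-+ 1# a c) (-‿cong (×-homo-+ 1# b d)))
              (sym ([a-b]+[c-d]≈[a+c]-[b+d] _ _ _ _)) }
    ; *-homo = λ { (a , b) (c , d) →
        trans (+-cong (trans (×-homo-+ 1# (a ℕ.* c) (b ℕ.* d)) (+-cong (×1-homo-* a c) (×1-homo-* b d)))
                      (-‿cong (trans (×-homo-+ 1# (a ℕ.* d) (b ℕ.* c)) (+-cong (×1-homo-* a d) (×1-homo-* b c)))))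
              (sym ([a-b]*[c-d]≈[ac+bd]-[ad+bc] _ _ _ _)) }
    ; -‿homo = λ { (a , b) → sym (⁻¹-anti-homo‿- _ _) }
    ; 0-homo = -‿inverseʳ 0#
    ; 1-homo = trans (+-congˡ ε⁻¹≈ε) (trans (+-identityʳ _) (+-identityʳ 1#))
    }

  equal? : ∀ m n → Maybe (⟦ m ⟧ ≈ ⟦ n ⟧)
  equal? (a , b) (c , d) with a ℕ.+ d ℕ.≟ c ℕ.+ b
  ... | yes a+d≡c+b = just (a+d≈c+b⇒a-b≈c-d
          (trans (sym (×-homo-+ 1# a d)) (trans (reflexive (≡.cong (_×ₙ 1#) a+d≡c+b)) (×-homo-+ 1# c b))))
  ... | no _        = nothing

  open import Algebra.Solver.Ring IntegerPairs (fromCommutativeRing K) homomorphism equal? public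
    using (solve; _:=_; _:+_; _:*_; _:-_; :-_)

module RingProperties {c ℓ : Level} (K : CommutativeRing c ℓ) where
  open CommutativeRing K
  open Poly K
  open RingSolver K
  open import Algebra.Properties.Semiring.Exp semiring using (_^_; ^-assocʳ)
  open import Algebra.Properties.CommutativeSemiring.Exp commutativeSemiring using (^-distrib-*)
  open import Algebra.Properties.Semiring.Mult semiring using (×-congʳ; ×-assoc-*; ×-assocˡ)
    renaming (_×_ to _×ₙ_)
  open import Algebra.Properties.Semiring.Sum semiring using (sum; sum-cong-≋; sum-init-last; sum-replicate-zero)
  open import Algebra.Properties.CommutativeSemiring.Binomial commutativeSemiring using (theorem; binomialTerm)
  open import Algebra.Properties.Group +-group using (inverseʳ-unique)
  open import Algebra.Properties.Ring ring using (x+x≈x⇒x≈0)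
  open import Data.Vec.Functional using (tail)
  open import Relation.Binary.Reasoning.Setoid setoid

  pow≡^ : ∀ z n → pow z n ≡ z ^ n
  pow≡^ z zero    = ≡.refl
  pow≡^ z (suc n) = ≡.cong (z *_) (pow≡^ z n)

  natMul≡×ₙ : ∀ n z → natMul n z ≡ n ×ₙ z
  natMul≡×ₙ zero    z = ≡.refl
  natMul≡×ₙ (suc n) z = ≡.cong (z +_) (natMul≡×ₙ n z)

  pow-cong : ∀ n {u v} → u ≈ v → pow u n ≈ pow v n
  pow-cong zero    u≈v = refl
  pow-cong (suc n) u≈v = *-cong u≈v (pow-cong n u≈v)

  pow-distribʳ-* : ∀ u v n → pow (u * v) n ≈ pow u n * pow v n
  pow-distribʳ-* u v n rewrite pow≡^ (u * v) n | pow≡^ u n | pow≡^ v n = ^-distrib-* u v n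

  pow-pow : ∀ u m n → pow (pow u m) n ≈ pow u (m ℕ.* n)
  pow-pow u m n rewrite pow≡^ (pow u m) n | pow≡^ u m | pow≡^ u (m ℕ.* n) = ^-assocʳ u m n

  pow-pow-^ : ∀ p u {i e} → i ≤ e → pow (pow u (p ^ℕ i)) (p ^ℕ (e ∸ i)) ≈ pow u (p ^ℕ e)
  pow-pow-^ p u {i} {e} i≤e = begin
    pow (pow u (p ^ℕ i)) (p ^ℕ (e ∸ i)) ≈⟨ pow-pow u (p ^ℕ i) (p ^ℕ (e ∸ i)) ⟩
    pow u (p ^ℕ i ℕ.* p ^ℕ (e ∸ i))     ≡⟨ ≡.cong (pow u) (ℕ.^-distribˡ-+-* p i (e ∸ i)) ⟨
    pow u (p ^ℕ (i ℕ.+ (e ∸ i)))        ≡⟨ ≡.cong (λ k → pow u (p ^ℕ k)) (ℕ.m+[n∸m]≡n i≤e) ⟩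
    pow u (p ^ℕ e)                      ∎

  sumTo-cong : ∀ n {g h} → (∀ i → i < n → g i ≈ h i) → sumTo n g ≈ sumTo n h
  sumTo-cong zero    g≈h = refl
  sumTo-cong (suc n) g≈h =
    +-cong (sumTo-cong n (λ i i<n → g≈h i (ℕ.m<n⇒m<1+n i<n))) (g≈h n (ℕ.n<1+n n))

  sumTo-+ : ∀ n (g h : ℕ → Carrier) → sumTo n (λ i → g i + h i) ≈ sumTo n g + sumTo n h
  sumTo-+ zero    g h = sym (+-identityʳ 0#)
  sumTo-+ (suc n) g h = trans (+-congʳ (sumTo-+ n g h))
    (solve 4 (λ G H g h → (G :+ H) :+ (g :+ h) := (G :+ g) :+ (H :+ h)) refl (sumTo n g) (sumTo n h) (g n) (h n))

  sumTo-linear : ∀ n u v (g h : ℕ → Carrier) →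
                 sumTo n (λ i → u * g i - v * h i) ≈ u * sumTo n g - v * sumTo n h
  sumTo-linear zero    u v g h = sym (trans (+-cong (zeroʳ u) (-‿cong (zeroʳ v))) (-‿inverseʳ 0#))
  sumTo-linear (suc n) u v g h = trans (+-congʳ (sumTo-linear n u v g h))
    (solve 6 (λ u v G H g h → (u :* G :- v :* H) :+ (u :* g :- v :* h) := u :* (G :+ g) :- v :* (H :+ h))
           refl u v (sumTo n g) (sumTo n h) (g n) (h n))

  sumTo-telescope : ∀ n (h : ℕ → Carrier) → sumTo n (λ i → h (suc i) - h i) ≈ h n - h 0
  sumTo-telescope zero    h = sym (-‿inverseʳ (h 0))
  sumTo-telescope (suc n) h = trans (+-congʳ (sumTo-telescope n h))
    (solve 3 (λ a b c → (b :- c) :+ (a :- b) := a :- c) refl (h (suc n)) (h n) (h 0))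

  module _ {p : ℕ} (char : natMul p 1# ≈ 0#) where

    p×ₙ≈0 : ∀ z → p ×ₙ z ≈ 0#
    p×ₙ≈0 z = begin
      p ×ₙ z        ≈⟨ ×-congʳ p (*-identityˡ z) ⟨
      p ×ₙ (1# * z) ≈⟨ ×-assoc-* p 1# z ⟨
      (p ×ₙ 1#) * z ≈⟨ *-congʳ (≡.subst (_≈ 0#) (natMul≡×ₙ p 1#) char) ⟩
      0# * z        ≈⟨ zeroˡ z ⟩
      0#            ∎

    pCk×ₙ≈0 : Prime p → ∀ {k} → 0 < k → k < p → ∀ z → (p C k) ×ₙ z ≈ 0#
    pCk×ₙ≈0 p-prime {k} 0<k k<p z with prime∣pCk p-prime 0<k k<p
    ... | divides q pCk≡q*p = begin
      (p C k) ×ₙ z   ≡⟨ ≡.cong (_×ₙ z) (≡.trans pCk≡q*p (ℕ.*-comm q p)) ⟩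
      (p ℕ.* q) ×ₙ z ≈⟨ ×-assocˡ z p q ⟨
      p ×ₙ (q ×ₙ z)  ≈⟨ p×ₙ≈0 (q ×ₙ z) ⟩
      0#             ∎

  -- In the binomial expansion of (u + v) ^ p all terms but the two extreme ones vanish.
  frobenius-+ : ∀ {p} → Prime p → natMul p 1# ≈ 0# → ∀ u v → pow (u + v) p ≈ pow u p + pow v p
  frobenius-+ {zero}      ()
  frobenius-+ {p@(suc m)} p-prime char u v = begin
    pow (u + v) p
      ≡⟨ pow≡^ (u + v) p ⟩
    (u + v) ^ p
      ≈⟨ theorem p u v ⟩
    term Fin.zero + sum (tail term)
      ≈⟨ +-congˡ (sum-init-last (tail term)) ⟩
    term Fin.zero + (sum (λ i → term (Fin.suc (inject₁ i))) + term (Fin.suc (fromℕ m)))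
      ≈⟨ +-cong first (+-cong middle last) ⟩
    pow v p + (0# + pow u p)
      ≈⟨ +-comm _ _ ⟩
    (0# + pow u p) + pow v p
      ≈⟨ +-congʳ (+-identityˡ _) ⟩
    pow u p + pow v p ∎
    where
    term : Fin (suc p) → Carrier
    term = binomialTerm u v p
    first : term Fin.zero ≈ pow v p
    first = trans (+-identityʳ _) (trans (*-identityˡ _) (reflexive (≡.sym (pow≡^ v p))))
    middle : sum (λ i → term (Fin.suc (inject₁ i))) ≈ 0#
    middle = trans (sum-cong-≋ (λ i → pCk×ₙ≈0 char p-prime (s≤s z≤n) (s≤s (Fin.inject₁ℕ< i)) _))
                   (sum-replicate-zero m)
    last : term (Fin.suc (fromℕ m)) ≈ pow u p
    last rewrite Fin.toℕ-fromℕ m | nCn≡1 p | ℕ.n∸n≡0 p =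
      trans (+-identityʳ _) (trans (*-identityʳ _) (reflexive (≡.sym (pow≡^ u p))))

  module ArtinSchreier {p : ℕ} (p-prime : Prime p) (char : natMul p 1# ≈ 0#) where

    ℘ : Carrier → Carrier
    ℘ z = pow z p - z

    ℘-+ : ∀ u v → ℘ (u + v) ≈ ℘ u + ℘ v
    ℘-+ u v = trans (+-congʳ (frobenius-+ p-prime char u v))
      (solve 4 (λ U V u v → (U :+ V) :- (u :+ v) := (U :- u) :+ (V :- v)) refl (pow u p) (pow v p) u v)

    ℘-cong : ∀ {u v} → u ≈ v → ℘ u ≈ ℘ v
    ℘-cong u≈v = +-cong (pow-cong p u≈v) (-‿cong u≈v)

    ℘-0 : ℘ 0# ≈ 0#
    ℘-0 = x+x≈x⇒x≈0 (℘ 0#) (trans (sym (℘-+ 0# 0#)) (℘-cong (+-identityʳ 0#)))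

    ℘-‿ : ∀ u → ℘ (- u) ≈ - ℘ u
    ℘-‿ u = inverseʳ-unique (℘ u) (℘ (- u))
      (trans (sym (℘-+ u (- u))) (trans (℘-cong (-‿inverseʳ u)) ℘-0))

    ℘-sumTo : ∀ n g → ℘ (sumTo n g) ≈ sumTo n (λ i → ℘ (g i))
    ℘-sumTo zero    g = ℘-0
    ℘-sumTo (suc n) g = trans (℘-+ (sumTo n g) (g n)) (+-congʳ (℘-sumTo n g))

    ℘-geometric : ∀ n u → ℘ (sumTo n (λ j → pow u (p ^ℕ j))) ≈ pow u (p ^ℕ n) - u
    ℘-geometric n u = begin
      ℘ (sumTo n (λ j → pow u (p ^ℕ j)))                  ≈⟨ ℘-sumTo n _ ⟩
      sumTo n (λ j → ℘ (pow u (p ^ℕ j)))                  ≈⟨ sumTo-cong n (λ j _ → +-congʳ (frobenius-step j)) ⟩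
      sumTo n (λ j → pow u (p ^ℕ suc j) - pow u (p ^ℕ j)) ≈⟨ sumTo-telescope n (λ j → pow u (p ^ℕ j)) ⟩
      pow u (p ^ℕ n) - pow u 1                            ≈⟨ +-congˡ (-‿cong (*-identityʳ u)) ⟩
      pow u (p ^ℕ n) - u                                  ∎
      where
      frobenius-step : ∀ j → pow (pow u (p ^ℕ j)) p ≈ pow u (p ^ℕ suc j)
      frobenius-step j = trans (pow-pow u (p ^ℕ j) p) (reflexive (≡.cong (pow u) (ℕ.*-comm (p ^ℕ j) p)))

    ℘-fR : ∀ e a x y →
      ℘ (fR p e a x y) ≈ (- (pow x (p ^ℕ e) * ER p e a y) + x * Rpol p e a y) + y * Rpol p e a x
    ℘-fR e a x y = begin
      ℘ (- sumTo e (λ i → A i + B i))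
        ≈⟨ ℘-‿ _ ⟩
      - ℘ (sumTo e (λ i → A i + B i))
        ≈⟨ -‿cong (trans (℘-sumTo e _) (sumTo-cong e (λ i _ → ℘-+ (A i) (B i)))) ⟩
      - sumTo e (λ i → ℘ (A i) + ℘ (B i))
        ≈⟨ -‿cong (trans (sumTo-+ e _ _) (+-cong ℘A ℘B)) ⟩
      - ((X * sumTo e Eterm - y * sumTo e Rterm) + (X * P - w))
        ≈⟨ solve 7 (λ X ΣE y ΣR P w aₑ →
                      :- ((X :* ΣE :- y :* ΣR) :+ (X :* P :- w))
                   := (:- (X :* (P :+ (ΣE :+ aₑ :* y))) :+ w) :+ y :* (ΣR :+ aₑ :* X))
                 refl X (sumTo e Eterm) y (sumTo e Rterm) P w (a e) ⟩
      (- (X * (P + (sumTo e Eterm + a e * y))) + w) + y * (sumTo e Rterm + a e * X)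
        ≈⟨ +-congʳ (+-congʳ (-‿cong (*-congˡ (+-congˡ (+-congˡ (sym Eterm-e)))))) ⟩
      (- (X * ER p e a y) + w) + y * Rpol p e a x ∎
      where
      Ry w X P : Carrier
      Ry = Rpol p e a y
      w  = x * Ry
      X  = pow x (p ^ℕ e)
      P  = pow Ry (p ^ℕ e)
      u A B Eterm Rterm : ℕ → Carrier
      u i = a i * pow x (p ^ℕ i) * y
      A i = sumTo (e ∸ i) (λ j → pow (u i) (p ^ℕ j))
      B i = pow w (p ^ℕ i)
      Eterm i = pow (a i * y) (p ^ℕ (e ∸ i))
      Rterm i = a i * pow x (p ^ℕ i)

      u^N≈X*Eterm : ∀ i → i < e → pow (u i) (p ^ℕ (e ∸ i)) ≈ X * Eterm i
      u^N≈X*Eterm i i<e = begin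
        pow (u i) N                        ≈⟨ pow-cong N (solve 3 (λ a xᵖ y → a :* xᵖ :* y := (a :* y) :* xᵖ)
                                                                 refl (a i) (pow x (p ^ℕ i)) y) ⟩
        pow ((a i * y) * pow x (p ^ℕ i)) N ≈⟨ pow-distribʳ-* (a i * y) (pow x (p ^ℕ i)) N ⟩
        Eterm i * pow (pow x (p ^ℕ i)) N   ≈⟨ *-congˡ (pow-pow-^ p x (ℕ.<⇒≤ i<e)) ⟩
        Eterm i * X                        ≈⟨ *-comm (Eterm i) X ⟩
        X * Eterm i                        ∎
        where
        N : ℕ
        N = p ^ℕ (e ∸ i)

      ℘A : sumTo e (λ i → ℘ (A i)) ≈ X * sumTo e Eterm - y * sumTo e Rterm
      ℘A = trans (sumTo-cong e (λ i i<e → trans (℘-geometric (e ∸ i) (u i))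
                                                  (+-cong (u^N≈X*Eterm i i<e) (-‿cong (u≈y*Rterm i)))))
                 (sumTo-linear e X y Eterm Rterm)
        where
        u≈y*Rterm : ∀ i → u i ≈ y * Rterm i
        u≈y*Rterm i = solve 3 (λ a xᵖ y → a :* xᵖ :* y := y :* (a :* xᵖ)) refl (a i) (pow x (p ^ℕ i)) y

      ℘B : sumTo e (λ i → ℘ (B i)) ≈ X * P - w
      ℘B = trans (sym (℘-sumTo e B)) (trans (℘-geometric e w) (+-congʳ (pow-distribʳ-* x Ry (p ^ℕ e))))

      Eterm-e : Eterm e ≈ a e * y
      Eterm-e rewrite ℕ.n∸n≡0 e = *-identityʳ (a e * y)

lemma2p2 : ∀ {c ℓ : Level} (K : CommutativeRing c ℓ) →
  let open CommutativeRing K in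
  let open Poly K in
  (p f : ℕ) → Prime p → 1 ≤ f → natMul p 1# ≈ 0# →
  (e : ℕ) (a : ℕ → Carrier) →
  (∀ i → i ≤ e → pow (a i) (p ^ℕ f) ≈ a i) →
  ¬ (a e ≈ 0#) →
  (x y : Carrier) →
  (pow (fR p e a x y) p - fR p e a x y
     ≈ (- (pow x (p ^ℕ e) * ER p e a y) + x * Rpol p e a y) + y * Rpol p e a x)
  × (ER p e a y ≈ 0# →
     pow (fR p e a x y) p - fR p e a x y ≈ x * Rpol p e a y + y * Rpol p e a x)
lemma2p2 K p _ p-prime _ char e a _ _ x y =
  ℘-fR e a x y , λ E≈0 → trans (℘-fR e a x y) (+-congʳ (E≈0⇒-[X*E]+w≈w E≈0))
  where
  open CommutativeRing K
  open Poly K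
  open RingProperties K
  open ArtinSchreier p-prime char
  open import Algebra.Properties.Group +-group using (ε⁻¹≈ε)

  E≈0⇒-[X*E]+w≈w : ∀ {E w} → E ≈ 0# → - (pow x (p ^ℕ e) * E) + w ≈ w
  E≈0⇒-[X*E]+w≈w E≈0 =
    trans (+-congʳ (trans (-‿cong (trans (*-congˡ E≈0) (zeroʳ _))) ε⁻¹≈ε)) (+-identityˡ _)
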